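{- For every integer partition $\lambda$, $b_\lambda(-1)$ equals the number of standard tableaux $T$ of shape $\lambda$ for which $c(T)$ is odd. In particular, $b_\lambda(-1)>0$ for every non-empty partition $\lambda$.
   Context: For a standard tableau $T$ of shape $\lambda=(\lambda_1,\dots,\lambda_m)$ (filling by $1,\dots,|\lambda|$ with rows and columns increasing) and $2\le j\le\lambda_i$, $c_{ij}(T)=\#\{i'\ge i:\text{cell }(i',j-1)\text{ exists and }T_{i',j-1}<T_{ij}\}$, $c(T)=\prod_i\prod_{j=2}^{\lambda_i}c_{ij}(T)$, $c_q(T)=\prod_i\prod_{j=2}^{\lambda_i}[c_{ij}(T)]_q$ with $[a]_q=1+q+\dots+q^{a-1}$, and $b_\lambda(q)=\sum_T c_q(T)$ over standard tableaux $T$ of shape $\lambda$. -}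

module Defs where

open import Data.Bool using (Bool; true; false; _∧_)
open import Data.Nat using (ℕ; zero; suc; _<_; _≥_; _<ᵇ_; _≡ᵇ_; _%_)
open import Data.List using (List; []; _∷_; _++_; map; zip; drop; length; concat; concatMap; upTo; filterᵇ)
open import Data.Nat.ListAction using (sum; product)
open import Data.List.Relation.Unary.All using (All)
open import Data.List.Relation.Unary.Linked using (Linked)
open import Data.Product using (_,_)
open import Data.Maybe using (Maybe; just; nothing)
open import Data.Integer as ℤ using (ℤ)

IsPartition : List ℕ → Set
IsPartition λs = Linked _≥_ λs Data.Product.× All (0 <_) λs
  where import Data.Product

-- A filling of a shape is a list of rows (row i = list of entries of row i,
-- read left to right).  Cells are 0-indexed internally.

nth : List ℕ → ℕ → Maybe ℕ
nth []       _       = nothing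
nth (x ∷ _)  zero    = just x
nth (_ ∷ xs) (suc k) = nth xs k

rowsOf : ℕ → ℕ → List (List ℕ)
rowsOf n zero    = [] ∷ []
rowsOf n (suc k) = concatMap (λ x → map (x ∷_) (rowsOf n k)) (map suc (upTo n))

fillings : ℕ → List ℕ → List (List (List ℕ))
fillings n []       = [] ∷ []
fillings n (k ∷ ks) = concatMap (λ r → map (r ∷_) (fillings n ks)) (rowsOf n k)

rowInc : List ℕ → Bool
rowInc []             = true
rowInc (x ∷ [])       = true
rowInc (x ∷ y ∷ xs)   = (x <ᵇ y) ∧ rowInc (y ∷ xs)

-- columns strictly increasing: row r above row s (s is not longer, zip truncates)
colInc : List ℕ → List ℕ → Bool
colInc (x ∷ r) (y ∷ s) = (x <ᵇ y) ∧ colInc r s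
colInc _       _       = true

colsInc : List (List ℕ) → Bool
colsInc []           = true
colsInc (r ∷ [])     = true
colsInc (r ∷ s ∷ ts) = colInc r s ∧ colsInc (s ∷ ts)

allᵇ : {A : Set} → (A → Bool) → List A → Bool
allᵇ p []       = true
allᵇ p (x ∷ xs) = p x ∧ allᵇ p xs

isPerm : ℕ → List (List ℕ) → Bool
isPerm n T = allᵇ (λ k → length (filterᵇ (λ x → x ≡ᵇ k) (concat T)) ≡ᵇ 1) (map suc (upTo n))

isStandard : ℕ → List (List ℕ) → Bool
isStandard n T = allᵇ rowInc T ∧ colsInc T ∧ isPerm n T

SYT : List ℕ → List (List (List ℕ))
SYT λs = filterᵇ (isStandard (sum λs)) (fillings (sum λs) λs)

cnt : List (List ℕ) → ℕ → ℕ → ℕ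
cnt rows j v = length (filterᵇ less rows)
  where
    less : List ℕ → Bool
    less s with nth s j
    ... | nothing = false
    ... | just x  = x <ᵇ v

-- c_{ij}(T) for the cells of the first row r of `rows` (rows = rows i, i+1, …),
-- columns j ≥ 2 (1-indexed): pairs (previous column index, entry T_{ij})
rowCounts : List (List ℕ) → List ℕ → List ℕ
rowCounts rows r = map (λ { (j , v) → cnt rows j v }) (zip (upTo (length r)) (drop 1 r))

cellCounts : List (List ℕ) → List ℕ
cellCounts []         = []
cellCounts (r ∷ rows) = rowCounts (r ∷ rows) r ++ cellCounts rows

c : List (List ℕ) → ℕ
c T = product (cellCounts T)

qint : ℤ → ℕ → ℤ
qint q a = Data.List.foldr ℤ._+_ (ℤ.+ 0) (map (q ℤ.^_) (upTo a))
  where import Data.List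

cq : ℤ → List (List ℕ) → ℤ
cq q T = Data.List.foldr ℤ._*_ (ℤ.+ 1) (map (qint q) (cellCounts T))
  where import Data.List

b : List ℕ → ℤ → ℤ
b λs q = Data.List.foldr ℤ._+_ (ℤ.+ 0) (map (cq q) (SYT λs))
  where import Data.List

oddCount : List ℕ → ℕ
oddCount λs = length (filterᵇ (λ T → c T % 2 ≡ᵇ 1) (SYT λs))

module Submission where

-- At q = −1 the q-integer [a]_q is 1 for odd a and 0 for even a, so c_{−1}(T) is 1 exactly when
-- every c_{ij}(T) is odd, i.e. when c(T) is odd, and 0 otherwise; summing over T gives the count.
-- Positivity: in the superstandard tableau, whose rows are filled with 1, 2, 3, … in reading order,
-- every entry below T_{ij} in column j − 1 of rows ≥ i lies in row i itself (later rows hold larger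
-- numbers), so every c_{ij} = 1 and c(T) = 1 is odd.

open import Defs
open import Data.Nat using (ℕ)
open import Data.List using (List; [])
open import Data.Integer using (ℤ; +_; -_; _>_)
open import Data.Product using (_×_)
open import Relation.Binary.PropositionalEquality using (_≡_; _≢_)

open import Data.Bool using (Bool; true; false; not; _∧_; _xor_; T; T?)
open import Data.Bool.Properties using (not-involutive; not-distribˡ-xor; ∧-distribʳ-xor; true-xor; T-≡)
open import Data.Nat using (zero; suc; _+_; _*_; _≤_; _<_; z≤n; s≤s; _<ᵇ_; _≡ᵇ_; _%_)
open import Data.Nat.Properties
  using (_≟_; _<?_; ≤-refl; ≤-trans; n≤1+n; n<1+n; m≤m+n; m<m+n; m<n⇒m<1+n; m≤n⇒m<n∨m≡n; ≤⇒≯; <⇒≢; >⇒≢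
        ; +-identityʳ; +-suc; +-assoc; +-monoʳ-≤; *-identityˡ)
open import Data.Nat.ListAction using (sum; product)
open import Data.List using (_∷_; _++_; map; foldr; zip; concat; upTo; applyUpTo; length; filterᵇ)
open import Data.List.Properties using (map-applyUpTo; map-upTo; map-cong; filter-≐)
open import Data.List.Membership.Propositional using (_∈_; lose)
open import Data.List.Membership.Propositional.Properties
  using (∈-map⁺; ∈-map⁻; ∈-concatMap⁺; ∈-upTo⁺; ∈-upTo⁻; ∈-filter⁺; ∈-length)
open import Data.List.Relation.Unary.All as All using (All; []; _∷_)
open import Data.List.Relation.Unary.All.Properties using (++⁺; map⁺)
open import Data.List.Relation.Unary.Any using (here; there)
open import Data.Integer using (1ℤ; -1ℤ; +<+) renaming (_+_ to _+ℤ_; _*_ to _*ℤ_; _^_ to _^ℤ_)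
import Data.Integer.Properties as ℤ
open import Data.Maybe using (just; nothing)
open import Data.Product using (_,_)
open import Data.Sum using (inj₁; inj₂)
open import Function using (_∘_; id)
open import Function.Bundles using (Equivalence)
open import Relation.Binary.PropositionalEquality using (refl; sym; trans; cong; cong₂; subst; module ≡-Reasoning)
open import Relation.Nullary.Decidable using (dec-true; dec-false)
open import Relation.Nullary.Negation using (contradiction)
open ≡-Reasoning

isOdd : ℕ → Bool
isOdd zero    = false
isOdd (suc n) = not (isOdd n)

isOdd-+ : ∀ m n → isOdd (m + n) ≡ isOdd m xor isOdd n
isOdd-+ zero    n = refl
isOdd-+ (suc m) n = trans (cong not (isOdd-+ m n)) (not-distribˡ-xor (isOdd m) (isOdd n))

isOdd-* : ∀ m n → isOdd (m * n) ≡ isOdd m ∧ isOdd n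
isOdd-* zero    n = refl
isOdd-* (suc m) n = begin
  isOdd (n + m * n)                  ≡⟨ isOdd-+ n (m * n) ⟩
  isOdd n xor isOdd (m * n)          ≡⟨ cong (isOdd n xor_) (isOdd-* m n) ⟩
  isOdd n xor (isOdd m ∧ isOdd n)    ≡⟨ ∧-distribʳ-xor (isOdd n) true (isOdd m) ⟨
  (true xor isOdd m) ∧ isOdd n       ≡⟨ cong (_∧ isOdd n) (true-xor (isOdd m)) ⟩
  not (isOdd m) ∧ isOdd n            ∎

isOdd-product : ∀ ns → isOdd (product ns) ≡ allᵇ isOdd ns
isOdd-product []       = refl
isOdd-product (n ∷ ns) = trans (isOdd-* n (product ns)) (cong (isOdd n ∧_) (isOdd-product ns))

n%2≡ᵇ1≡isOdd : ∀ n → (n % 2 ≡ᵇ 1) ≡ isOdd n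
n%2≡ᵇ1≡isOdd zero          = refl
n%2≡ᵇ1≡isOdd (suc zero)    = refl
n%2≡ᵇ1≡isOdd (suc (suc n)) = trans (n%2≡ᵇ1≡isOdd n) (sym (not-involutive (isOdd n)))

indicator : Bool → ℤ
indicator true  = 1ℤ
indicator false = + 0

indicator-∧ : ∀ x y → indicator x *ℤ indicator y ≡ indicator (x ∧ y)
indicator-∧ true  true  = refl
indicator-∧ true  false = refl
indicator-∧ false y     = refl

sumℤ : List ℤ → ℤ
sumℤ = foldr _+ℤ_ (+ 0)

productℤ : List ℤ → ℤ
productℤ = foldr _*ℤ_ 1ℤ

sumℤ-scale : ∀ {A : Set} q (f : A → ℤ) xs → sumℤ (map (λ x → q *ℤ f x) xs) ≡ q *ℤ sumℤ (map f xs)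
sumℤ-scale q f []       = sym (ℤ.*-zeroʳ q)
sumℤ-scale q f (x ∷ xs) = trans (cong (q *ℤ f x +ℤ_) (sumℤ-scale q f xs))
                                (sym (ℤ.*-distribˡ-+ q (f x) (sumℤ (map f xs))))

qint-suc : ∀ q a → qint q (suc a) ≡ 1ℤ +ℤ q *ℤ qint q a
qint-suc q a = cong (1ℤ +ℤ_) (begin
  sumℤ (map (q ^ℤ_) (applyUpTo suc a))       ≡⟨ cong sumℤ (map-applyUpTo suc (q ^ℤ_) a) ⟩
  sumℤ (applyUpTo (λ k → q *ℤ q ^ℤ k) a)     ≡⟨ cong sumℤ (map-upTo (λ k → q *ℤ q ^ℤ k) a) ⟨
  sumℤ (map (λ k → q *ℤ q ^ℤ k) (upTo a))    ≡⟨ sumℤ-scale q (q ^ℤ_) (upTo a) ⟩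
  q *ℤ qint q a                              ∎)

qint-[-1] : ∀ a → qint -1ℤ a ≡ indicator (isOdd a)
qint-[-1] zero    = refl
qint-[-1] (suc a) =
  trans (qint-suc -1ℤ a) (trans (cong (λ z → 1ℤ +ℤ -1ℤ *ℤ z) (qint-[-1] a)) (flip (isOdd a)))
  where
  flip : ∀ x → 1ℤ +ℤ -1ℤ *ℤ indicator x ≡ indicator (not x)
  flip true  = refl
  flip false = refl

productℤ-qint-[-1] : ∀ ns → productℤ (map (qint -1ℤ) ns) ≡ indicator (allᵇ isOdd ns)
productℤ-qint-[-1] []       = refl
productℤ-qint-[-1] (n ∷ ns) =
  trans (cong₂ _*ℤ_ (qint-[-1] n) (productℤ-qint-[-1] ns)) (indicator-∧ (isOdd n) (allᵇ isOdd ns))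

cq-[-1] : ∀ T → cq -1ℤ T ≡ indicator (c T % 2 ≡ᵇ 1)
cq-[-1] T = begin
  cq -1ℤ T                                ≡⟨ productℤ-qint-[-1] (cellCounts T) ⟩
  indicator (allᵇ isOdd (cellCounts T))   ≡⟨ cong indicator (isOdd-product (cellCounts T)) ⟨
  indicator (isOdd (c T))                 ≡⟨ cong indicator (n%2≡ᵇ1≡isOdd (c T)) ⟨
  indicator (c T % 2 ≡ᵇ 1)                ∎

sumℤ-indicator : ∀ {A : Set} (p : A → Bool) xs → sumℤ (map (indicator ∘ p) xs) ≡ + length (filterᵇ p xs)
sumℤ-indicator p []       = refl
sumℤ-indicator p (x ∷ xs) with p x
... | true  = cong (1ℤ +ℤ_) (sumℤ-indicator p xs)
... | false = trans (ℤ.+-identityˡ _) (sumℤ-indicator p xs)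

b-[-1] : ∀ λs → b λs -1ℤ ≡ + oddCount λs
b-[-1] λs = trans (cong sumℤ (map-cong cq-[-1] (SYT λs))) (sumℤ-indicator (λ T → c T % 2 ≡ᵇ 1) (SYT λs))

<ᵇ-true : ∀ {m n} → m < n → (m <ᵇ n) ≡ true
<ᵇ-true {m} {n} = dec-true (m <? n)

<ᵇ-false : ∀ {m n} → n ≤ m → (m <ᵇ n) ≡ false
<ᵇ-false {m} {n} n≤m = dec-false (m <? n) (≤⇒≯ n≤m)

≡ᵇ-false : ∀ {m n} → m ≢ n → (m ≡ᵇ n) ≡ false
≡ᵇ-false {m} {n} = dec-false (m ≟ n)

∈-filterᵇ⁺ : ∀ {A : Set} (p : A → Bool) {x xs} → x ∈ xs → p x ≡ true → x ∈ filterᵇ p xs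
∈-filterᵇ⁺ p x∈xs px = ∈-filter⁺ (T? ∘ p) x∈xs (Equivalence.from T-≡ px)

allᵇ-true : ∀ {A : Set} (p : A → Bool) xs → (∀ {x} → x ∈ xs → p x ≡ true) → allᵇ p xs ≡ true
allᵇ-true p []       _ = refl
allᵇ-true p (x ∷ xs) h rewrite h (here refl) = allᵇ-true p xs (h ∘ there)

consecutive : ℕ → ℕ → List ℕ
consecutive a zero    = []
consecutive a (suc k) = a ∷ consecutive (suc a) k

superstandard : ℕ → List ℕ → List (List ℕ)
superstandard offset []       = []
superstandard offset (k ∷ ks) = consecutive (suc offset) k ∷ superstandard (offset + k) ks

consecutive∈rowsOf : ∀ n a k → a + k ≤ n → consecutive (suc a) k ∈ rowsOf n k
consecutive∈rowsOf n a zero    _ = here refl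
consecutive∈rowsOf n a (suc k) a+1+k≤n =
  ∈-concatMap⁺ (λ x → map (x ∷_) (rowsOf n k))
    (lose (∈-map⁺ suc (∈-upTo⁺ (≤-trans (s≤s (m≤m+n a k)) 1+a+k≤n)))
          (∈-map⁺ (suc a ∷_) (consecutive∈rowsOf n (suc a) k 1+a+k≤n)))
  where
  1+a+k≤n : suc a + k ≤ n
  1+a+k≤n = subst (_≤ n) (+-suc a k) a+1+k≤n

superstandard∈fillings : ∀ n offset ks → offset + sum ks ≤ n → superstandard offset ks ∈ fillings n ks
superstandard∈fillings n o []       _ = here refl
superstandard∈fillings n o (k ∷ ks) le =
  ∈-concatMap⁺ (λ r → map (r ∷_) (fillings n ks))
    (lose (consecutive∈rowsOf n o k (≤-trans (+-monoʳ-≤ o (m≤m+n k (sum ks))) le))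
          (∈-map⁺ (consecutive (suc o) k ∷_)
                  (superstandard∈fillings n (o + k) ks (subst (_≤ n) (sym (+-assoc o k (sum ks))) le))))

rowInc-consecutive : ∀ a k → rowInc (consecutive a k) ≡ true
rowInc-consecutive a zero          = refl
rowInc-consecutive a (suc zero)    = refl
rowInc-consecutive a (suc (suc k)) = cong₂ _∧_ (<ᵇ-true (n<1+n a)) (rowInc-consecutive (suc a) (suc k))

rowsInc-superstandard : ∀ offset ks → allᵇ rowInc (superstandard offset ks) ≡ true
rowsInc-superstandard o []       = refl
rowsInc-superstandard o (k ∷ ks) = cong₂ _∧_ (rowInc-consecutive (suc o) k) (rowsInc-superstandard (o + k) ks)

colInc-consecutive : ∀ a b k l → a < b → colInc (consecutive a k) (consecutive b l) ≡ true
colInc-consecutive a b zero    l       _   = refl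
colInc-consecutive a b (suc k) zero    _   = refl
colInc-consecutive a b (suc k) (suc l) a<b =
  cong₂ _∧_ (<ᵇ-true a<b) (colInc-consecutive (suc a) (suc b) k l (s≤s a<b))

colsInc-superstandard : ∀ offset ks → colsInc (superstandard offset ks) ≡ true
colsInc-superstandard o []           = refl
colsInc-superstandard o (k ∷ [])     = refl
colsInc-superstandard o (k ∷ l ∷ ks) = cong₂ _∧_ (first-two-rows k) (colsInc-superstandard (o + k) (l ∷ ks))
  where
  first-two-rows : ∀ k → colInc (consecutive (suc o) k) (consecutive (suc (o + k)) l) ≡ true
  first-two-rows zero    = refl
  first-two-rows (suc k) = colInc-consecutive (suc o) (suc (o + suc k)) (suc k) l (s≤s (m<m+n o (s≤s z≤n)))

consecutive-++ : ∀ a k l → consecutive a (k + l) ≡ consecutive a k ++ consecutive (a + k) l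
consecutive-++ a zero    l = cong (λ b → consecutive b l) (sym (+-identityʳ a))
consecutive-++ a (suc k) l =
  cong (a ∷_) (trans (consecutive-++ (suc a) k l)
                     (cong (λ b → consecutive (suc a) k ++ consecutive b l) (sym (+-suc a k))))

concat-superstandard : ∀ offset ks → concat (superstandard offset ks) ≡ consecutive (suc offset) (sum ks)
concat-superstandard o []       = refl
concat-superstandard o (k ∷ ks) =
  trans (cong (consecutive (suc o) k ++_) (concat-superstandard (o + k) ks))
        (sym (consecutive-++ (suc o) k (sum ks)))

count : ℕ → List ℕ → ℕ
count x xs = length (filterᵇ (λ y → y ≡ᵇ x) xs)

count-consecutive-below : ∀ x a m → x < a → count x (consecutive a m) ≡ 0
count-consecutive-below x a zero    x<a = refl
count-consecutive-below x a (suc m) x<a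
  rewrite ≡ᵇ-false (>⇒≢ x<a) = count-consecutive-below x (suc a) m (m<n⇒m<1+n x<a)

count-consecutive : ∀ x a m → a ≤ x → x < a + m → count x (consecutive a m) ≡ 1
count-consecutive x a zero    a≤x x<a+0 = contradiction (subst (x <_) (+-identityʳ a) x<a+0) (≤⇒≯ a≤x)
count-consecutive x a (suc m) a≤x x<a+1+m with m≤n⇒m<n∨m≡n a≤x
... | inj₂ refl rewrite dec-true (a ≟ a) refl = cong suc (count-consecutive-below a (suc a) m (n<1+n a))
... | inj₁ a<x  rewrite ≡ᵇ-false (<⇒≢ a<x) =
  count-consecutive x (suc a) m a<x (subst (x <_) (+-suc a m) x<a+1+m)

isPerm-superstandard : ∀ ks → isPerm (sum ks) (superstandard 0 ks) ≡ true
isPerm-superstandard ks rewrite concat-superstandard 0 ks =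
  allᵇ-true _ (map suc (upTo (sum ks))) occurs-once
  where
  occurs-once : ∀ {x} → x ∈ map suc (upTo (sum ks)) → (count x (consecutive 1 (sum ks)) ≡ᵇ 1) ≡ true
  occurs-once x∈ with i , i∈ , refl ← ∈-map⁻ suc x∈ =
    cong (_≡ᵇ 1) (count-consecutive (suc i) 1 (sum ks) (s≤s z≤n) (s≤s (∈-upTo⁻ i∈)))

isStandard-superstandard : ∀ ks → isStandard (sum ks) (superstandard 0 ks) ≡ true
isStandard-superstandard ks
  rewrite rowsInc-superstandard 0 ks | colsInc-superstandard 0 ks = isPerm-superstandard ks

superstandard∈SYT : ∀ ks → superstandard 0 ks ∈ SYT ks
superstandard∈SYT ks =
  ∈-filterᵇ⁺ (isStandard (sum ks)) (superstandard∈fillings (sum ks) 0 ks ≤-refl) (isStandard-superstandard ks)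

nth-∈ : ∀ {x} s j → nth s j ≡ just x → x ∈ s
nth-∈ (y ∷ s) zero    refl = here refl
nth-∈ (y ∷ s) (suc j) e    = there (nth-∈ s j e)

nth-consecutive : ∀ a k j → j < k → nth (consecutive a k) j ≡ just (a + j)
nth-consecutive a (suc k) zero    _         = cong just (sym (+-identityʳ a))
nth-consecutive a (suc k) (suc j) (s≤s j<k) = trans (nth-consecutive (suc a) k j j<k) (cong just (sym (+-suc a j)))

entryBelow : ℕ → ℕ → List ℕ → Bool
entryBelow j v s with nth s j
... | nothing = false
... | just x  = x <ᵇ v

filterᵇ-cong : ∀ {A : Set} {p q : A → Bool} → (∀ x → p x ≡ q x) → ∀ xs → filterᵇ p xs ≡ filterᵇ q xs
filterᵇ-cong {p = p} {q} p≗q =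
  filter-≐ (T? ∘ p) (T? ∘ q) ((λ {x} → subst T (p≗q x)) , (λ {x} → subst T (sym (p≗q x))))

-- The predicate local to `cnt` cannot be named here (Agda treats it as depending on all of `rows`),
-- so its agreement with `entryBelow` is stated with its left-hand side left to unification.
mutual
  cnt-as-filter : ∀ rows j v → cnt rows j v ≡ length (filterᵇ (entryBelow j v) rows)
  cnt-as-filter rows j v = cong length (filterᵇ-cong (cnt-predicate≗entryBelow rows j v) rows)

  cnt-predicate≗entryBelow : ∀ (rows : List (List ℕ)) j v s → _ ≡ entryBelow j v s
  cnt-predicate≗entryBelow rows j v s with nth s j
  ... | nothing = refl
  ... | just x  = refl

entryBelow-false : ∀ j v s → All (v ≤_) s → entryBelow j v s ≡ false
entryBelow-false j v s s≥v with nth s j in e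
... | nothing = refl
... | just x  = <ᵇ-false (All.lookup s≥v (nth-∈ s j e))

count-entryBelow-≡0 : ∀ j v rows → All (All (v ≤_)) rows → length (filterᵇ (entryBelow j v) rows) ≡ 0
count-entryBelow-≡0 j v []         []                = refl
count-entryBelow-≡0 j v (s ∷ rows) (s≥v ∷ rows≥v)
  rewrite entryBelow-false j v s s≥v = count-entryBelow-≡0 j v rows rows≥v

entryBelow-consecutive : ∀ a k j → j < k → entryBelow j (suc (a + j)) (consecutive a k) ≡ true
entryBelow-consecutive a k j j<k rewrite nth-consecutive a k j j<k = <ᵇ-true (n<1+n (a + j))

cnt-consecutive : ∀ a k rest j → j < k → All (All (a + k ≤_)) rest →
  cnt (consecutive a k ∷ rest) j (suc (a + j)) ≡ 1
cnt-consecutive a k rest j j<k rest≥a+k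
  rewrite cnt-as-filter (consecutive a k ∷ rest) j (suc (a + j)) | entryBelow-consecutive a k j j<k =
  cong suc (count-entryBelow-≡0 j (suc (a + j)) rest (All.map (All.map (≤-trans 1+a+j≤a+k)) rest≥a+k))
  where
  1+a+j≤a+k : suc (a + j) ≤ a + k
  1+a+j≤a+k = subst (_≤ a + k) (+-suc a j) (+-monoʳ-≤ a j<k)

All-zip-consecutive : ∀ {P : ℕ × ℕ → Set} (f : ℕ → ℕ) n b m →
  (∀ i → i < m → P (f i , b + i)) → All P (zip (applyUpTo f n) (consecutive b m))
All-zip-consecutive         f zero    b m       _ = []
All-zip-consecutive         f (suc n) b zero    _ = []
All-zip-consecutive {P = P} f (suc n) b (suc m) h =
  subst (λ v → P (f 0 , v)) (+-identityʳ b) (h 0 (s≤s z≤n))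
  ∷ All-zip-consecutive (f ∘ suc) n (suc b) m
      (λ i i<m → subst (λ v → P (f (suc i) , v)) (+-suc b i) (h (suc i) (s≤s i<m)))

rowCounts-consecutive : ∀ a k rest → All (All (a + k ≤_)) rest →
  All (_≡ 1) (rowCounts (consecutive a k ∷ rest) (consecutive a k))
rowCounts-consecutive a zero    rest _         = []
rowCounts-consecutive a (suc k) rest rest≥a+k =
  map⁺ (All-zip-consecutive id (suc (length (consecutive (suc a) k))) (suc a) k
         (λ i i<k → cnt-consecutive a (suc k) rest i (m<n⇒m<1+n i<k) rest≥a+k))

consecutive-≥ : ∀ a k → All (a ≤_) (consecutive a k)
consecutive-≥ a zero    = []
consecutive-≥ a (suc k) = ≤-refl ∷ All.map (≤-trans (n≤1+n a)) (consecutive-≥ (suc a) k)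

superstandard-> : ∀ offset ks → All (All (offset <_)) (superstandard offset ks)
superstandard-> o []       = []
superstandard-> o (k ∷ ks) =
  consecutive-≥ (suc o) k ∷ All.map (All.map (≤-trans (s≤s (m≤m+n o k)))) (superstandard-> (o + k) ks)

cellCounts-superstandard : ∀ offset ks → All (_≡ 1) (cellCounts (superstandard offset ks))
cellCounts-superstandard o []       = []
cellCounts-superstandard o (k ∷ ks) =
  ++⁺ (rowCounts-consecutive (suc o) k _ (superstandard-> (o + k) ks)) (cellCounts-superstandard (o + k) ks)

product-ones : ∀ {ns} → All (_≡ 1) ns → product ns ≡ 1
product-ones {[]}     []         = refl
product-ones {1 ∷ ns} (refl ∷ h) = trans (*-identityˡ (product ns)) (product-ones h)

c-superstandard : ∀ offset ks → c (superstandard offset ks) ≡ 1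
c-superstandard o ks = product-ones (cellCounts-superstandard o ks)

oddCount-positive : ∀ λs → 0 < oddCount λs
oddCount-positive λs =
  ∈-length (∈-filterᵇ⁺ (λ T → c T % 2 ≡ᵇ 1) (superstandard∈SYT λs)
                       (cong (λ n → n % 2 ≡ᵇ 1) (c-superstandard 0 λs)))

theorem3p13 : (λs : List ℕ) → IsPartition λs →
    (b λs (- (+ 1)) ≡ + (oddCount λs)) × (λs ≢ [] → b λs (- (+ 1)) > + 0)
theorem3p13 λs _ = b-[-1] λs , λ _ → subst (_> + 0) (sym (b-[-1] λs)) (+<+ (oddCount-positive λs))
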